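{- Every statement of the form $\Gamma\vdash_{ps}$ or $\Gamma\vdash_{ps}x:A$ has at most one derivation.
   Context: Types over a fixed countably infinite set of variables: $\star$ and $\mathrm{Hom}_A(t,u)$ for a type $A$ and variables $t,u$. Contexts are lists $x_1:A_1,\dots,x_n:A_n$; $FV(\Gamma)$ denotes the set of variables occurring in $\Gamma$. The judgments $\Gamma\vdash_{ps}$ and $\Gamma\vdash_{ps}x:A$ are generated by the rules: $x:\star\vdash_{ps}x:\star$; from $\Gamma\vdash_{ps}x:A$ infer $\Gamma,y:A,f:\mathrm{Hom}_A(x,y)\vdash_{ps}f:\mathrm{Hom}_A(x,y)$ provided $y,f\notin FV(\Gamma)$; from $\Gamma\vdash_{ps}f:\mathrm{Hom}_A(x,y)$ infer $\Gamma\vdash_{ps}y:A$; from $\Gamma\vdash_{ps}x:\star$ infer $\Gamma\vdash_{ps}$. -}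

module Defs where

open import Data.Nat using (ℕ)
open import Data.List using (List; []; _∷_; _++_)
open import Data.List.Membership.Propositional using (_∉_)

Var : Set
Var = ℕ

data Ty : Set where
  ⋆   : Ty
  Hom : Ty → Var → Var → Ty

infixl 5 _▸_∶_
data Ctx : Set where
  ∅     : Ctx
  _▸_∶_ : Ctx → Var → Ty → Ctx

FVTy : Ty → List Var
FVTy ⋆ = []
FVTy (Hom A t u) = t ∷ u ∷ FVTy A

FV : Ctx → List Var
FV ∅ = []
FV (Γ ▸ x ∶ A) = x ∷ FVTy A ++ FV Γ

-- Γ ⊢ps x : A   (side conditions are irrelevant arguments: a derivation
-- does not carry a proof of a side condition, only the fact that it holds)
data _⊢ps_∶_ : Ctx → Var → Ty → Set where
  ps-base : ∀ {x} → (∅ ▸ x ∶ ⋆) ⊢ps x ∶ ⋆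
  ps-ext  : ∀ {Γ x A y f} → Γ ⊢ps x ∶ A →
            .(y ∉ FV Γ) → .(f ∉ FV Γ) →
            ((Γ ▸ y ∶ A) ▸ f ∶ Hom A x y) ⊢ps f ∶ Hom A x y
  ps-tgt  : ∀ {Γ f A x y} → Γ ⊢ps f ∶ Hom A x y → Γ ⊢ps y ∶ A

data _⊢ps : Ctx → Set where
  ps-ctx : ∀ {Γ x} → Γ ⊢ps x ∶ ⋆ → Γ ⊢ps

module Submission where

open import Defs
open import Data.Product using (_×_; _,_)
open import Relation.Binary.PropositionalEquality using (_≡_; refl; cong; sym; trans)
open import Data.Nat using (ℕ; suc; pred; _+_)
open import Data.Nat.Properties using (+-suc; +-cancelʳ-≡; m+1+n≢0; m+1+n≢n)
open import Data.Empty using (⊥-elim)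

-- A derivation of Γ ⊢ps t : T starts from the last declaration of Γ and then
-- takes targets, each lowering the dimension of the type by one. So the
-- number of target steps, and with it the judgement, is fixed by dim T; and
-- a derivation is then fixed by its judgement, by induction.

dim : Ty → ℕ
dim ⋆ = 0
dim (Hom A _ _) = suc (dim A)

-- The value at ∅ is junk: no derivation has an empty context.
lastTy : Ctx → Ty
lastTy ∅ = ⋆
lastTy (Γ ▸ _ ∶ A) = A

codim : ∀ {Γ t T} → Γ ⊢ps t ∶ T → ℕ
codim ps-base = 0
codim (ps-ext _ _ _) = 0
codim (ps-tgt d) = suc (codim d)

codim+dim≡dim-lastTy : ∀ {Γ t T} (d : Γ ⊢ps t ∶ T) → codim d + dim T ≡ dim (lastTy Γ)
codim+dim≡dim-lastTy ps-base = refl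
codim+dim≡dim-lastTy (ps-ext _ _ _) = refl
codim+dim≡dim-lastTy (ps-tgt {A = A} d) =
  trans (sym (+-suc (codim d) (dim A))) (codim+dim≡dim-lastTy d)

-- The clause at ⋆ is junk: only Hom-typed judgements have a target.
target : Var × Ty → Var × Ty
target (t , ⋆) = t , ⋆
target (_ , Hom A _ y) = y , A

codim-determines-judgement : ∀ {Γ t T t′ T′} (d : Γ ⊢ps t ∶ T) (d′ : Γ ⊢ps t′ ∶ T′) →
                             codim d ≡ codim d′ → (t , T) ≡ (t′ , T′)
codim-determines-judgement ps-base ps-base _ = refl
codim-determines-judgement (ps-ext _ _ _) (ps-ext _ _ _) _ = refl
codim-determines-judgement (ps-tgt d) (ps-tgt d′) eq =
  cong target (codim-determines-judgement d d′ (cong pred eq))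
codim-determines-judgement ps-base (ps-tgt _) ()
codim-determines-judgement (ps-ext _ _ _) (ps-tgt _) ()
codim-determines-judgement (ps-tgt _) ps-base ()
codim-determines-judgement (ps-tgt _) (ps-ext _ _ _) ()

dim-determines-judgement : ∀ {Γ t T t′ T′} → Γ ⊢ps t ∶ T → Γ ⊢ps t′ ∶ T′ →
                           dim T ≡ dim T′ → (t , T) ≡ (t′ , T′)
dim-determines-judgement {T = T} d d′ eq =
  codim-determines-judgement d d′ (+-cancelʳ-≡ (dim T) (codim d) (codim d′) same-sum)
  where
  same-sum : codim d + dim T ≡ codim d′ + dim T
  same-sum = trans (codim+dim≡dim-lastTy d)
                   (trans (sym (codim+dim≡dim-lastTy d′)) (cong (codim d′ +_) (sym eq)))

⊢ps∶-unique : ∀ {Γ t T} (d d′ : Γ ⊢ps t ∶ T) → d ≡ d′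
⊢ps∶-unique ps-base ps-base = refl
⊢ps∶-unique (ps-ext e y∉Γ f∉Γ) (ps-ext e′ _ _) = cong (λ e → ps-ext e y∉Γ f∉Γ) (⊢ps∶-unique e e′)
⊢ps∶-unique (ps-tgt d) (ps-tgt d′) with dim-determines-judgement d d′ refl
... | refl = cong ps-tgt (⊢ps∶-unique d d′)
⊢ps∶-unique ps-base (ps-tgt d′) = ⊥-elim (m+1+n≢0 (codim d′) (codim+dim≡dim-lastTy d′))
⊢ps∶-unique (ps-tgt d) ps-base = ⊥-elim (m+1+n≢0 (codim d) (codim+dim≡dim-lastTy d))
⊢ps∶-unique (ps-ext _ _ _) (ps-tgt d′) = ⊥-elim (m+1+n≢n (codim d′) (codim+dim≡dim-lastTy d′))
⊢ps∶-unique (ps-tgt d) (ps-ext _ _ _) = ⊥-elim (m+1+n≢n (codim d) (codim+dim≡dim-lastTy d))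

⊢ps-unique : ∀ {Γ} (d d′ : Γ ⊢ps) → d ≡ d′
⊢ps-unique (ps-ctx d) (ps-ctx d′) with dim-determines-judgement d d′ refl
... | refl = cong ps-ctx (⊢ps∶-unique d d′)

mainTheorem11 : ((Γ : Ctx) (d d′ : Γ ⊢ps) → d ≡ d′)
    × ((Γ : Ctx) (x : Var) (A : Ty) (d d′ : Γ ⊢ps x ∶ A) → d ≡ d′)
mainTheorem11 = (λ _ → ⊢ps-unique) , (λ _ _ _ → ⊢ps∶-unique)
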